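{- For every sufficiently small $\varepsilon>0$ there is $\gamma_0>0$ such that for every $\gamma\in(0,\gamma_0]$ there is $n_0$ such that for all $n\geq n_0$: if $G$ is a graph on $n$ vertices with $\delta(G)\geq n/2$ that is $\gamma$-close to $2K_{n/2}$, then $G$ is an $\varepsilon$-superextremal two-clique with some partition $V(G)=A\uplus B$ witnessing the definition, and moreover, for this partition, either every vertex of $G$ has at least one neighbour on the other side of the partition, or every vertex of $A$ has at least $2$ neighbours in $B$, or every vertex of $B$ has at least $2$ neighbours in $A$.
   Context: A graph $G$ on $n$ vertices is $\gamma$-close to $2K_{n/2}$ if there is $A\subseteq V(G)$ with $|A|=\lfloor n/2\rfloor$ and at most $\gamma n^2$ edges between $A$ and $V(G)\setminus A$. For $v\in V(G)$ and $S\subseteq V(G)$, $d_G(v,S)$ is the number of neighbours of $v$ in $S$. A graph $G$ on $n$ vertices is an $\varepsilon$-superextremal two-clique if there is a partition $V(G)=A\uplus B$ with: (A1) $||A|-|B||\leq\varepsilon n$; (A2) $d_G(a,A)\geq(1/2-\varepsilon)n$ for all but at most $\varepsilon n$ vertices $a\in A$; (A3) $d_G(a,A)\geq(1/4-\varepsilon)n$ for all $a\in A$; (A4) $d_G(b,B)\geq(1/2-\varepsilon)n$ for all but at most $\varepsilon n$ vertices $b\in B$; (A5) $d_G(b,B)\geq(1/4-\varepsilon)n$ for all $b\in B$. -}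

module Defs where

open import Data.Bool using (Bool; true; false; if_then_else_; _∧_)
open import Data.Nat as ℕ using (ℕ; zero; suc; ⌊_/2⌋)
open import Data.Fin using (Fin)
open import Data.Fin.Subset using (Subset; ∁; _∈_; _∉_) renaming (∣_∣ to size)
open import Data.Fin.Subset.Properties using (_∈?_)
open import Data.List using (List; map; filter; length)
open import Data.Nat.ListAction using (sum)
open import Data.Integer using (+_)
open import Data.Rational using (ℚ; _/_; _*_; _-_; _≤_; ∣_∣)
open import Data.Product using (_×_)
open import Data.Sum using (_⊎_)
open import Relation.Binary.PropositionalEquality using (_≡_)
open import Relation.Nullary.Decidable using (⌊_⌋)
import Data.List as L

allV : (n : ℕ) → List (Fin n)
allV n = L.allFin n

record Graph (n : ℕ) : Set where
  field
    adj     : Fin n → Fin n → Bool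
    sym     : ∀ u v → adj u v ≡ adj v u
    irrefl  : ∀ v → adj v v ≡ false
open Graph public

ℕ→ℚ : ℕ → ℚ
ℕ→ℚ k = + k / 1

count : {n : ℕ} → (Fin n → Bool) → ℕ
count {n} p = length (L.filter (λ v → Relation.Nullary.Decidable.Core.T? (p v)) (allV n))
  where import Relation.Nullary.Decidable.Core

mem : {n : ℕ} → Fin n → Subset n → Bool
mem v S = ⌊ v ∈? S ⌋

deg : {n : ℕ} → Graph n → Fin n → Subset n → ℕ
deg G v S = count (λ w → mem w S ∧ adj G v w)

full : (n : ℕ) → Subset n
full n = Data.Fin.Subset.⊤
  where import Data.Fin.Subset

MinDegHalf : {n : ℕ} → Graph n → Set
MinDegHalf {n} G = ∀ v → n ℕ.≤ 2 ℕ.* deg G v (full n)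

crossEdges : {n : ℕ} → Graph n → Subset n → ℕ
crossEdges G A = sum (map (λ a → if mem a A then deg G a (∁ A) else 0) (allV _))

Close : {n : ℕ} → ℚ → Graph n → Set
Close {n} γ G = Data.Product.∃ λ (A : Subset n) →
  (size A ≡ ⌊ n /2⌋) × (ℕ→ℚ (crossEdges G A) ≤ γ * ℕ→ℚ (n ℕ.* n))

Superextremal : {n : ℕ} → ℚ → Graph n → Subset n → Set
Superextremal {n} ε G A =
    (∣ ℕ→ℚ (size A) - ℕ→ℚ (size B) ∣ ≤ ε * N)
  × (ℕ→ℚ (count (λ a → mem a A ∧ lowA a (½ - ε))) ≤ ε * N)
  × (∀ a → a ∈ A → (+ 1 / 4 - ε) * N ≤ ℕ→ℚ (deg G a A))
  × (ℕ→ℚ (count (λ b → mem b B ∧ lowB b (½ - ε))) ≤ ε * N)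
  × (∀ b → b ∈ B → (+ 1 / 4 - ε) * N ≤ ℕ→ℚ (deg G b B))
  where
    open import Data.Rational using (½; _<?_)
    B : Subset n
    B = ∁ A
    N : ℚ
    N = ℕ→ℚ n
    lowA : Fin n → ℚ → Bool
    lowA a c = ⌊ ℕ→ℚ (deg G a A) <? c * N ⌋
    lowB : Fin n → ℚ → Bool
    lowB b c = ⌊ ℕ→ℚ (deg G b B) <? c * N ⌋

CrossCondition : {n : ℕ} → Graph n → Subset n → Set
CrossCondition {n} G A =
    (∀ v → (v ∈ A → 1 ℕ.≤ deg G v (∁ A)) × (v ∉ A → 1 ℕ.≤ deg G v A))
  ⊎ (∀ a → a ∈ A → 2 ℕ.≤ deg G a (∁ A))
  ⊎ (∀ b → b ∉ A → 2 ℕ.≤ deg G b A)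

module Submission where

-- Given ε > 0 choose K ≥ 1 with 1/K ≤ ε, and put γ₀ = 1/(16K²) and n₀ = 2K.
-- Let G have δ(G) ≥ n/2 and let A, with |A| = ⌊n/2⌋, send at most n²/(16K²)
-- edges across.  The witnessing partition is the majority repartition
-- A' ⊎ ∁A': every vertex joins the side of A ⊎ ∁A in which it has more
-- neighbours.  Markov's inequality applied to the crossing edges shows that
-- few vertices change side and few have ≥ n/(2K) neighbours across; this gives
-- (A1)-(A5) for A' in integer form, with 1/K in place of ε, and a final step
-- turns these into the rational inequalities of the definition.  The
-- "moreover" part holds for every partition of a graph with δ(G) ≥ n/2: a
-- vertex with no neighbour across forces its side to have more than n/2
-- vertices, and then every vertex of the other side has two neighbours across.

module Counting where

  open import Data.Bool using (Bool; true; false; T; not)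
  open import Data.Fin using (Fin; zero; suc)
  open import Data.Nat using (ℕ; zero; suc; z≤n; s≤s; _+_; _*_; _≤_)
  open import Data.Nat.Properties as ℕ
    using (+-*-semiring; ≤-refl; ≤-trans; ≤-reflexive; +-mono-≤; m≤m+n; m≤n+m)
  open import Data.Sum using (_⊎_; inj₁; inj₂)
  open import Relation.Binary.PropositionalEquality
    using (_≡_; refl; sym; trans; cong)
  open import Algebra.Properties.Semiring.Sum +-*-semiring public
    using (sum; sum-cong-≗; ∑-distrib-+; ∑-comm; *-distribˡ-sum; *-distribʳ-sum)

  𝟙 : Bool → ℕ
  𝟙 true  = 1
  𝟙 false = 0

  # : ∀ {n} → (Fin n → Bool) → ℕ
  # p = sum (λ i → 𝟙 (p i))

  sum-mono : ∀ {n} {f g : Fin n → ℕ} → (∀ i → f i ≤ g i) → sum f ≤ sum g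
  sum-mono {zero}  _   = z≤n
  sum-mono {suc n} f≤g = +-mono-≤ (f≤g zero) (sum-mono (λ i → f≤g (suc i)))

  term≤sum : ∀ {n} (f : Fin n → ℕ) i → f i ≤ sum f
  term≤sum f zero    = m≤m+n (f zero) _
  term≤sum f (suc i) = ≤-trans (term≤sum (λ j → f (suc j)) i) (m≤n+m _ (f zero))

  𝟙-cover : ∀ {a b c} → (T a → T b ⊎ T c) → 𝟙 a ≤ 𝟙 b + 𝟙 c
  𝟙-cover {false}                 _ = z≤n
  𝟙-cover {true} {true}           _ = s≤s z≤n
  𝟙-cover {true} {false} {true}   _ = ≤-refl
  𝟙-cover {true} {false} {false} h with h _
  ... | inj₁ ()
  ... | inj₂ ()

  #-cover : ∀ {n} (p q r : Fin n → Bool) →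
            (∀ i → T (p i) → T (q i) ⊎ T (r i)) → # p ≤ # q + # r
  #-cover p q r cover = ≤-trans (sum-mono (λ i → 𝟙-cover (cover i)))
                                (≤-reflexive (∑-distrib-+ (λ i → 𝟙 (q i)) (λ i → 𝟙 (r i))))

  #-complement : ∀ {n} (p q : Fin n → Bool) → (∀ i → q i ≡ not (p i)) → # p + # q ≡ n
  #-complement p q q≡¬p = trans (sym (∑-distrib-+ (λ i → 𝟙 (p i)) (λ i → 𝟙 (q i))))
                                (trans (sum-cong-≗ one) (#-all _))
    where
    one : ∀ i → 𝟙 (p i) + 𝟙 (q i) ≡ 1
    one i rewrite q≡¬p i with p i
    ... | true  = refl
    ... | false = refl
    #-all : ∀ n → sum {n} (λ _ → 1) ≡ n
    #-all zero    = refl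
    #-all (suc n) = cong suc (#-all n)

  markov : ∀ {n} (P : Fin n → Bool) (f : Fin n → ℕ) t c →
           (∀ i → T (P i) → t ≤ c * f i) → # P * t ≤ c * sum f
  markov P f t c bound = begin
    # P * t                    ≡⟨ *-distribʳ-sum t (λ i → 𝟙 (P i)) ⟩
    sum (λ i → 𝟙 (P i) * t)    ≤⟨ sum-mono pointwise ⟩
    sum (λ i → c * f i)        ≡⟨ sym (*-distribˡ-sum c f) ⟩
    c * sum f                  ∎
    where
    open ℕ.≤-Reasoning
    pointwise : ∀ i → 𝟙 (P i) * t ≤ c * f i
    pointwise i with P i | bound i
    ... | true  | b = ≤-trans (≤-reflexive (ℕ.+-identityʳ t)) (b _)
    ... | false | _ = z≤n

module GraphCounting where

  open import Defs hiding (sym)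
  open Counting
  open import Data.Bool using (Bool; true; false; T; not; _∧_; if_then_else_)
  open import Data.Bool.Properties using (T-≡; not-involutive)
  open import Data.Fin using (Fin; zero; suc; _≟_)
  open import Data.Fin.Subset using (Subset; ∁; ⊤) renaming (∣_∣ to size)
  open import Data.Fin.Subset.Properties using (_∈?_; ∈⊤; x∈∁p⇒x∉p; x∉p⇒x∈∁p)
  import Data.List as List
  open import Data.Nat.ListAction using () renaming (sum to listSum)
  open import Data.Nat using (ℕ; zero; suc; z≤n; s≤s; _+_; _*_; _≤_)
  open import Data.Nat.Properties as ℕ using (≤-trans; ≤-reflexive; +-monoˡ-≤)
  open import Data.Sum using (_⊎_; inj₁; inj₂)
  open import Data.Vec using ([]; _∷_; tabulate)
  open import Data.Vec.Properties using ([]=⇒lookup; lookup⇒[]=; lookup∘tabulate)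
  open import Function using (Equivalence)
  open import Relation.Binary.PropositionalEquality
    using (_≡_; refl; sym; trans; cong; subst)
  open import Relation.Nullary using (¬_; yes; no; contradiction)
  open import Relation.Nullary.Decidable using (⌊_⌋; T?; toWitness)

  ⟦_⟧ : ∀ {n} → Subset n → Fin n → Bool
  ⟦ S ⟧ v = mem v S

  mem-∁ : ∀ {n} (S : Subset n) v → mem v (∁ S) ≡ not (mem v S)
  mem-∁ S v with v ∈? S | v ∈? ∁ S
  ... | yes v∈S | yes v∈∁S = contradiction v∈S (x∈∁p⇒x∉p v∈∁S)
  ... | yes _   | no _     = refl
  ... | no _    | yes _    = refl
  ... | no v∉S  | no v∉∁S  = contradiction (x∉p⇒x∈∁p v∉S) v∉∁S

  mem-∁′ : ∀ {n} (S : Subset n) v → mem v S ≡ not (mem v (∁ S))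
  mem-∁′ S v = trans (sym (not-involutive (mem v S))) (cong not (sym (mem-∁ S v)))

  ∁-excludes : ∀ {n} (S : Subset n) v → T (mem v (∁ S)) → ¬ T (mem v S)
  ∁-excludes S v v∈∁S v∈S = x∈∁p⇒x∉p (toWitness v∈∁S) (toWitness v∈S)

  mem-⊤ : ∀ {n} (v : Fin n) → mem v (full n) ≡ true
  mem-⊤ v with v ∈? ⊤
  ... | yes _  = refl
  ... | no v∉⊤ = contradiction ∈⊤ v∉⊤

  mem-tabulate : ∀ {n} (f : Fin n → Bool) v → mem v (tabulate f) ≡ f v
  mem-tabulate f v with v ∈? tabulate f | f v in fv
  ... | yes v∈ | _     = trans (sym ([]=⇒lookup v∈)) (trans (lookup∘tabulate f v) fv)
  ... | no _   | false = refl
  ... | no v∉  | true  = contradiction (lookup⇒[]= v (tabulate f) (trans (lookup∘tabulate f v) fv)) v∉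

  mem-suc : ∀ {n} (v : Fin n) b (S : Subset n) → mem (suc v) (b ∷ S) ≡ mem v S
  mem-suc v b S with v ∈? S
  ... | yes _ = refl
  ... | no _  = refl

  ⟦⟧-cover : ∀ {n} (S : Subset n) w → T (⟦ S ⟧ w) ⊎ T (⟦ ∁ S ⟧ w)
  ⟦⟧-cover S w rewrite mem-∁ S w with mem w S
  ... | true  = inj₁ _
  ... | false = inj₂ _

  size≡# : ∀ {n} (S : Subset n) → size S ≡ # ⟦ S ⟧
  size≡# []          = refl
  size≡# (true ∷ S)  = cong suc (trans (size≡# S) (sum-cong-≗ (λ i → cong 𝟙 (sym (mem-suc i true S)))))
  size≡# (false ∷ S) = trans (size≡# S) (sum-cong-≗ (λ i → cong 𝟙 (sym (mem-suc i false S))))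

  count≡# : ∀ {n} (p : Fin n → Bool) → count p ≡ # p
  count≡# {n} p = count-tabulate n (λ i → i)
    where
    count-tabulate : ∀ m (g : Fin m → Fin n) →
         List.length (List.filter (λ v → T? (p v)) (List.tabulate g))
           ≡ sum (λ i → 𝟙 (p (g i)))
    count-tabulate zero    g = refl
    count-tabulate (suc m) g with p (g zero)
    ... | true  = cong suc (count-tabulate m (λ i → g (suc i)))
    ... | false = count-tabulate m (λ i → g (suc i))

  degIn : ∀ {n} → Graph n → Fin n → (Fin n → Bool) → ℕ
  degIn G v p = # (λ w → p w ∧ adj G v w)

  cut : ∀ {n} → Graph n → (p q : Fin n → Bool) → ℕ
  cut G p q = sum (λ v → 𝟙 (p v) * degIn G v q)

  deg≡degIn : ∀ {n} (G : Graph n) v S → deg G v S ≡ degIn G v ⟦ S ⟧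
  deg≡degIn G v S = count≡# (λ w → mem w S ∧ adj G v w)

  crossEdges≡cut : ∀ {n} (G : Graph n) A → crossEdges G A ≡ cut G ⟦ A ⟧ ⟦ ∁ A ⟧
  crossEdges≡cut {n} G A = trans (sum-tabulate n (λ i → i)) (sum-cong-≗ term)
    where
    h : Fin n → ℕ
    h a = if mem a A then deg G a (∁ A) else 0
    sum-tabulate : ∀ m (g : Fin m → Fin n) → listSum (List.map h (List.tabulate g)) ≡ sum (λ i → h (g i))
    sum-tabulate zero    g = refl
    sum-tabulate (suc m) g = cong (h (g zero) +_) (sum-tabulate m (λ i → g (suc i)))
    term : ∀ a → h a ≡ 𝟙 (⟦ A ⟧ a) * degIn G a ⟦ ∁ A ⟧
    term a with mem a A
    ... | true  = trans (deg≡degIn G a (∁ A)) (sym (ℕ.+-identityʳ _))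
    ... | false = refl

  cut-sym : ∀ {n} (G : Graph n) p q → cut G p q ≡ cut G q p
  cut-sym {n} G p q = begin
    sum (λ a → 𝟙 (p a) * degIn G a q)                   ≡⟨ sum-cong-≗ (λ a → *-distribˡ-sum (𝟙 (p a)) (edgesFrom a q)) ⟩
    sum {n} (λ a → sum (λ w → 𝟙 (p a) * edgesFrom a q w)) ≡⟨ ∑-comm (λ a w → 𝟙 (p a) * edgesFrom a q w) ⟩
    sum {n} (λ w → sum (λ a → 𝟙 (p a) * edgesFrom a q w)) ≡⟨ sum-cong-≗ (λ w → sum-cong-≗ (λ a → edge a w)) ⟩
    sum {n} (λ w → sum (λ a → 𝟙 (q w) * edgesFrom w p a)) ≡⟨ sum-cong-≗ (λ w → sym (*-distribˡ-sum (𝟙 (q w)) (edgesFrom w p))) ⟩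
    sum (λ b → 𝟙 (q b) * degIn G b p)                   ∎
    where
    open Relation.Binary.PropositionalEquality.≡-Reasoning
    edgesFrom : Fin n → (Fin n → Bool) → Fin n → ℕ
    edgesFrom a r w = 𝟙 (r w ∧ adj G a w)
    edge : ∀ a w → 𝟙 (p a) * edgesFrom a q w ≡ 𝟙 (q w) * edgesFrom w p a
    edge a w rewrite Graph.sym G a w with p a | q w | adj G w a
    ... | true  | true  | true  = refl
    ... | true  | true  | false = refl
    ... | true  | false | _     = refl
    ... | false | true  | true  = refl
    ... | false | true  | false = refl
    ... | false | false | _     = refl

  degIn-cover : ∀ {n} (G : Graph n) v (p q r : Fin n → Bool) →
                (∀ w → T (p w) → T (q w) ⊎ T (r w)) → degIn G v p ≤ degIn G v q + # r
  degIn-cover G v p q r cover = #-cover _ _ r (λ w → restrict (cover w))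
    where
    restrict : ∀ {a b c e} → (T a → T b ⊎ T c) → T (a ∧ e) → T (b ∧ e) ⊎ T c
    restrict {true} {true}  {e = true} _ _ = inj₁ _
    restrict {true} {false} {e = true} h t = h t
    restrict {true} {true}  {e = false} _ ()
    restrict {true} {false} {e = false} _ ()

  deg-split : ∀ {n} (G : Graph n) v (p q : Fin n → Bool) → (∀ w → q w ≡ not (p w)) →
              deg G v (full n) ≡ degIn G v p + degIn G v q
  deg-split G v p q q≡¬p = trans (deg≡degIn G v _)
    (trans (sum-cong-≗ pointwise) (∑-distrib-+ (λ w → 𝟙 (p w ∧ adj G v w)) (λ w → 𝟙 (q w ∧ adj G v w))))
    where
    pointwise : ∀ w → 𝟙 (mem w (full _) ∧ adj G v w) ≡ 𝟙 (p w ∧ adj G v w) + 𝟙 (q w ∧ adj G v w)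
    pointwise w rewrite mem-⊤ w | q≡¬p w with p w | adj G v w
    ... | true  | true  = refl
    ... | true  | false = refl
    ... | false | true  = refl
    ... | false | false = refl

  -- A vertex is not its own neighbour, so d(v,p) < |p| whenever v satisfies p.
  degIn-own : ∀ {n} (G : Graph n) v (p : Fin n → Bool) → T (p v) → suc (degIn G v p) ≤ # p
  degIn-own {n} G v p pv = begin
    1 + degIn G v p                                      ≤⟨ +-monoˡ-≤ (degIn G v p) (≤-trans (≤-reflexive (sym isV-v)) (term≤sum isV v)) ⟩
    sum isV + degIn G v p                                ≡⟨ sym (∑-distrib-+ isV (λ w → 𝟙 (p w ∧ adj G v w))) ⟩
    sum (λ w → isV w + 𝟙 (p w ∧ adj G v w))              ≤⟨ sum-mono pointwise ⟩
    # p                                                  ∎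
    where
    open ℕ.≤-Reasoning
    isV : Fin n → ℕ
    isV w = 𝟙 ⌊ w ≟ v ⌋
    isV-v : isV v ≡ 1
    isV-v with v ≟ v
    ... | yes _  = refl
    ... | no v≢v = contradiction refl v≢v
    pointwise : ∀ w → isV w + 𝟙 (p w ∧ adj G v w) ≤ 𝟙 (p w)
    pointwise w with w ≟ v
    ... | yes refl rewrite Graph.irrefl G w | Equivalence.to T-≡ pv = s≤s z≤n
    ... | no _ with p w | adj G v w
    ...   | true  | true  = s≤s z≤n
    ...   | true  | false = z≤n
    ...   | false | _     = z≤n

  minDeg-split : ∀ {n} (G : Graph n) → MinDegHalf G → (p q : Fin n → Bool) →
                 (∀ w → q w ≡ not (p w)) → ∀ v → n ≤ 2 * (degIn G v p + degIn G v q)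
  minDeg-split G minDeg p q q≡¬p v = subst (λ d → _ ≤ 2 * d) (deg-split G v p q q≡¬p) (minDeg v)


module Attachment where

  open import Defs hiding (sym)
  open Counting
  open GraphCounting
  open import Data.Bool using (Bool; T; not)
  open import Data.Fin using (Fin)
  open import Data.Fin.Properties using (any?)
  open import Data.Fin.Subset using (Subset; ∁)
  open import Data.Fin.Subset.Properties using (x∉p⇒x∈∁p)
  open import Data.Nat using (ℕ; suc; _+_; _*_; _≤_)
  open import Data.Nat.Properties as ℕ
    using (≤-trans; ≤-reflexive; +-monoˡ-≤; +-monoʳ-≤; +-mono-≤; *-monoʳ-≤; n≢0⇒n>0)
  open import Data.Nat.Solver using (module +-*-Solver)
  open import Data.Product using (∃; _×_; _,_)
  open import Data.Sum using (inj₁; inj₂)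
  open import Relation.Binary.PropositionalEquality using (_≡_; refl; sym; cong; subst)
  open import Relation.Nullary using (Dec; yes; no)
  open import Relation.Nullary.Decidable using (T?; _×-dec_; fromWitness)
  open +-*-Solver using (solve; _:+_; _:*_; _:=_; con)

  -- The arithmetic core: with d(v,q) = 0 the p side has ≥ n/2 + 1 vertices, so
  -- the q side has ≤ n/2 - 1 and a vertex b of it has d(b,p) ≥ n/2 - d(b,q) ≥ 2.
  two-from-sizes : ∀ n dp dq sp sq → n ≤ 2 * (dp + dq) → suc dq ≤ sq → n + 2 ≤ 2 * sp →
                   sp + sq ≡ n → 2 ≤ dp
  two-from-sizes n dp dq sp sq deg dq<sq big sizes =
    ℕ.*-cancelˡ-≤ 2 (ℕ.+-cancelʳ-≤ (n + n) 4 (2 * dp) (begin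
      4 + (n + n)                  ≡⟨ solve 1 (λ n → con 4 :+ (n :+ n) := (n :+ con 2) :+ (n :+ con 2)) refl n ⟩
      (n + 2) + (n + 2)            ≤⟨ +-mono-≤ (+-monoˡ-≤ 2 deg) big ⟩
      (2 * (dp + dq) + 2) + 2 * sp ≡⟨ solve 3 (λ a b c → (con 2 :* (a :+ b) :+ con 2) :+ con 2 :* c
                                                      := con 2 :* a :+ (con 2 :* (con 1 :+ b) :+ con 2 :* c)) refl dp dq sp ⟩
      2 * dp + (2 * suc dq + 2 * sp) ≤⟨ +-monoʳ-≤ (2 * dp) (+-monoˡ-≤ (2 * sp) (*-monoʳ-≤ 2 dq<sq)) ⟩
      2 * dp + (2 * sq + 2 * sp)   ≡⟨ cong (2 * dp +_) (solve 2 (λ a b → con 2 :* a :+ con 2 :* b := con 2 :* (b :+ a)) refl sq sp) ⟩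
      2 * dp + 2 * (sp + sq)       ≡⟨ cong (λ s → 2 * dp + 2 * s) sizes ⟩
      2 * dp + 2 * n               ≡⟨ cong (2 * dp +_) (cong (n +_) (ℕ.+-identityʳ n)) ⟩
      2 * dp + (n + n)             ∎))
    where open ℕ.≤-Reasoning

  isolated⇒two-neighbours :
    ∀ {n} (G : Graph n) (p q : Fin n → Bool) → (∀ w → q w ≡ not (p w)) →
    (∀ v → n ≤ 2 * (degIn G v p + degIn G v q)) →
    (∃ λ v → T (p v) × degIn G v q ≡ 0) → ∀ b → T (q b) → 2 ≤ degIn G b p
  isolated⇒two-neighbours {n} G p q q≡¬p minDeg (v , pv , isolated) b qb =
    two-from-sizes n (degIn G b p) (degIn G b q) (# p) (# q)
      (minDeg b) (degIn-own G b q qb) p-large (#-complement p q q≡¬p)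
    where
    p-large : n + 2 ≤ 2 * # p
    p-large = begin
      n + 2                                ≤⟨ +-monoˡ-≤ 2 (minDeg v) ⟩
      2 * (degIn G v p + degIn G v q) + 2  ≡⟨ cong (λ d → 2 * (degIn G v p + d) + 2) isolated ⟩
      2 * (degIn G v p + 0) + 2            ≡⟨ solve 1 (λ a → con 2 :* (a :+ con 0) :+ con 2 := con 2 :* (con 1 :+ a)) refl (degIn G v p) ⟩
      2 * suc (degIn G v p)                ≤⟨ *-monoʳ-≤ 2 (degIn-own G v p pv) ⟩
      2 * # p                              ∎
      where open ℕ.≤-Reasoning

  -- The "moreover" part of the theorem holds for every partition of a graph with
  -- δ(G) ≥ n/2: either no vertex is isolated from the other side, or one side
  -- contains such a vertex and then the other side is doubly attached.
  crossCondition : ∀ {n} (G : Graph n) → MinDegHalf G → (S : Subset n) → CrossCondition G S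
  crossCondition {n} G minDeg S = decide (isolatedIn ⟦ S ⟧ ⟦ ∁ S ⟧) (isolatedIn ⟦ ∁ S ⟧ ⟦ S ⟧)
    where
    isolatedIn : (p q : Fin n → Bool) → Dec (∃ λ v → T (p v) × degIn G v q ≡ 0)
    isolatedIn p q = any? (λ v → T? (p v) ×-dec (degIn G v q ℕ.≟ 0))
    attached : (p q : Fin n → Bool) → (∀ w → q w ≡ not (p w)) →
               (∃ λ v → T (p v) × degIn G v q ≡ 0) → ∀ b → T (q b) → 2 ≤ degIn G b p
    attached p q q≡¬p = isolated⇒two-neighbours G p q q≡¬p (minDeg-split G minDeg p q q≡¬p)
    decide : Dec (∃ λ v → T (⟦ S ⟧ v) × degIn G v ⟦ ∁ S ⟧ ≡ 0) →
             Dec (∃ λ v → T (⟦ ∁ S ⟧ v) × degIn G v ⟦ S ⟧ ≡ 0) → CrossCondition G S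
    decide (yes isoA) _ = inj₂ (inj₂ λ b b∉S → subst (2 ≤_) (sym (deg≡degIn G b S))
      (attached ⟦ S ⟧ ⟦ ∁ S ⟧ (mem-∁ S) isoA b (fromWitness (x∉p⇒x∈∁p b∉S))))
    decide (no _) (yes isoB) = inj₂ (inj₁ λ a a∈S → subst (2 ≤_) (sym (deg≡degIn G a (∁ S)))
      (attached ⟦ ∁ S ⟧ ⟦ S ⟧ (mem-∁′ S) isoB a (fromWitness a∈S)))
    decide (no noIsoA) (no noIsoB) = inj₁ λ v →
        (λ v∈S → subst (1 ≤_) (sym (deg≡degIn G v (∁ S)))
                   (n≢0⇒n>0 λ d≡0 → noIsoA (v , fromWitness v∈S , d≡0)))
      , (λ v∉S → subst (1 ≤_) (sym (deg≡degIn G v S))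
                   (n≢0⇒n>0 λ d≡0 → noIsoB (v , fromWitness (x∉p⇒x∈∁p v∉S) , d≡0)))

module Majority where

  open import Defs hiding (sym)
  open Counting
  open GraphCounting
  open import Data.Bool using (Bool; true; T; _∧_)
  open import Data.Fin using (Fin)
  open import Data.Fin.Subset using (Subset; ∁; _∈_) renaming (∣_∣ to size)
  open import Data.Vec using (tabulate)
  open import Data.Nat using (ℕ; zero; suc; z≤n; s≤s; _+_; _*_; _≤_; _<_; _≤ᵇ_; NonZero; >-nonZero; >-nonZero⁻¹; ⌊_/2⌋)
  open import Data.Nat.Properties as ℕ
    using (≤-trans; ≤-reflexive; <⇒≤; +-monoˡ-≤; +-monoʳ-≤; +-mono-≤; *-monoʳ-≤; *-monoˡ-≤; m≤m*n; ≤ᵇ⇒≤; ≤⇒≤ᵇ)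
  open import Data.Nat.Solver using (module +-*-Solver)
  open import Data.Product using (_×_; _,_; proj₁; proj₂)
  open import Data.Sum using (_⊎_; inj₁; inj₂; swap)
  open import Relation.Binary.PropositionalEquality using (_≡_; refl; sym; trans; cong; subst; subst₂)
  open import Relation.Nullary using (¬_; yes; no; contradiction)
  open import Relation.Nullary.Decidable using (fromWitness)
  open import Data.Bool.Properties using (T-∧)
  open import Function using (_∘_; Equivalence)
  open +-*-Solver using (solve; _:+_; _:*_; _:=_; con)

  ∧-elim : ∀ {a b} → T (a ∧ b) → T a × T b
  ∧-elim = Equivalence.to T-∧

  ∧-intro : ∀ {a b} → T a → T b → T (a ∧ b)
  ∧-intro x y = Equivalence.from T-∧ (x , y)

  module Side {n} .{{_ : NonZero n}} (G : Graph n) (K : ℕ) .{{_ : NonZero K}}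
    (p q p' q' : Fin n → Bool)
    (p∨q   : ∀ w → T (p w) ⊎ T (q w))
    (p'∨q' : ∀ w → T (p' w) ⊎ T (q' w))
    (minDeg : ∀ v → n ≤ 2 * (degIn G v p + degIn G v q))
    (p'-major : ∀ v → T (p' v) → degIn G v q ≤ degIn G v p)
    (q'-major : ∀ v → T (q' v) → degIn G v p ≤ degIn G v q)
    (sparse : 16 * K * K * cut G p q ≤ n * n)
    where

    open ℕ.≤-Reasoning

    few-by-cut : ∀ (P : Fin n → Bool) c →
                 (∀ v → T (P v) → T (p v) × n ≤ c * degIn G v q) → 16 * K * K * # P ≤ c * n
    few-by-cut P c large = ℕ.*-cancelʳ-≤ (16 * K * K * # P) (c * n) n (begin
      16 * K * K * # P * n   ≡⟨ solve 3 (λ m x n → m :* x :* n := m :* (x :* n)) refl (16 * K * K) (# P) n ⟩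
      16 * K * K * (# P * n) ≤⟨ *-monoʳ-≤ (16 * K * K) (markov P (λ v → 𝟙 (p v) * degIn G v q) n c bound) ⟩
      16 * K * K * (c * e)   ≡⟨ solve 3 (λ m c e → m :* (c :* e) := c :* (m :* e)) refl (16 * K * K) c e ⟩
      c * (16 * K * K * e)   ≤⟨ *-monoʳ-≤ c sparse ⟩
      c * (n * n)            ≡⟨ sym (ℕ.*-assoc c n n) ⟩
      c * n * n              ∎)
      where
      e : ℕ
      e = cut G p q
      bound : ∀ v → T (P v) → n ≤ c * (𝟙 (p v) * degIn G v q)
      bound v Pv with p v | large v Pv
      ... | true | _ , big = ≤-trans big (≤-reflexive (cong (c *_) (sym (ℕ.+-identityʳ _))))

    movedOut : Fin n → Bool
    movedOut v = p v ∧ q' v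

    movedOut-small : 4 * K * # movedOut ≤ n
    movedOut-small = ℕ.*-cancelˡ-≤ 4 (begin
      4 * (4 * K * # movedOut)     ≤⟨ *-monoʳ-≤ 4 (m≤m*n (4 * K * # movedOut) K) ⟩
      4 * (4 * K * # movedOut * K) ≡⟨ solve 2 (λ k x → con 4 :* (con 4 :* k :* x :* k) := con 16 :* k :* k :* x) refl K (# movedOut) ⟩
      16 * K * K * # movedOut      ≤⟨ few-by-cut movedOut 4 mostlyInQ ⟩
      4 * n                        ∎)
      where
      mostlyInQ : ∀ v → T (movedOut v) → T (p v) × n ≤ 4 * degIn G v q
      mostlyInQ v out = pv , (begin
        n                                 ≤⟨ minDeg v ⟩
        2 * (degIn G v p + degIn G v q)   ≤⟨ *-monoʳ-≤ 2 (+-monoˡ-≤ _ (q'-major v q'v)) ⟩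
        2 * (degIn G v q + degIn G v q)   ≡⟨ solve 1 (λ d → con 2 :* (d :+ d) := con 4 :* d) refl (degIn G v q) ⟩
        4 * degIn G v q                   ∎)
        where
        pv : T (p v)
        pv = proj₁ (∧-elim out)
        q'v : T (q' v)
        q'v = proj₂ (∧-elim out)

    degIn-p≤p' : ∀ v → degIn G v p ≤ degIn G v p' + # movedOut
    degIn-p≤p' v = degIn-cover G v p p' movedOut stays
      where
      stays : ∀ w → T (p w) → T (p' w) ⊎ T (movedOut w)
      stays w pw with p'∨q' w
      ... | inj₁ p'w = inj₁ p'w
      ... | inj₂ q'w = inj₂ (∧-intro pw q'w)

    major-degree : ∀ v → T (p' v) → K * n ≤ 4 * K * degIn G v p' + n
    major-degree v p'v = begin
      K * n                                          ≤⟨ *-monoʳ-≤ K (minDeg v) ⟩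
      K * (2 * (degIn G v p + degIn G v q))          ≤⟨ *-monoʳ-≤ K (*-monoʳ-≤ 2 (+-monoʳ-≤ (degIn G v p) (p'-major v p'v))) ⟩
      K * (2 * (degIn G v p + degIn G v p))          ≡⟨ solve 2 (λ k d → k :* (con 2 :* (d :+ d)) := con 4 :* k :* d) refl K (degIn G v p) ⟩
      4 * K * degIn G v p                            ≤⟨ *-monoʳ-≤ (4 * K) (degIn-p≤p' v) ⟩
      4 * K * (degIn G v p' + # movedOut)            ≡⟨ ℕ.*-distribˡ-+ (4 * K) _ _ ⟩
      4 * K * degIn G v p' + 4 * K * # movedOut      ≤⟨ +-monoʳ-≤ _ movedOut-small ⟩
      4 * K * degIn G v p' + n                       ∎

    qHeavy : Fin n → Bool
    qHeavy v = p v ∧ (n ≤ᵇ 2 * K * degIn G v q)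

    qHeavy-small : 8 * K * # qHeavy ≤ n
    qHeavy-small = ℕ.*-cancelˡ-≤ 2 (ℕ.*-cancelˡ-≤ K (begin
      K * (2 * (8 * K * # qHeavy)) ≡⟨ solve 2 (λ k h → k :* (con 2 :* (con 8 :* k :* h)) := con 16 :* k :* k :* h) refl K (# qHeavy) ⟩
      16 * K * K * # qHeavy        ≤⟨ few-by-cut qHeavy (2 * K) (λ v heavy → proj₁ (∧-elim heavy) , ≤ᵇ⇒≤ _ _ (proj₂ (∧-elim heavy))) ⟩
      2 * K * n                    ≡⟨ solve 2 (λ k n → con 2 :* k :* n := k :* (con 2 :* n)) refl K n ⟩
      K * (2 * n)                  ∎))

    -- (A2)-type bound: given that few vertices move from q into p', few vertices
    -- of p' have degree below (1/2 - 1/K)n in p'.  Such a vertex either came from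
    -- q or lies in p with at least n/(2K) neighbours in q.
    few-low : ∀ (lo : Fin n → Bool) →
              (∀ v → T (p' v) → T (lo v) → ¬ (K * n ≤ 2 * K * degIn G v p' + 2 * n)) →
              4 * K * # (λ v → q v ∧ p' v) ≤ n → K * # (λ v → p' v ∧ lo v) ≤ n
    few-low lo low movedIn-small = ℕ.*-cancelˡ-≤ 4 (begin
      4 * (K * # low')                  ≤⟨ *-monoʳ-≤ 4 (*-monoʳ-≤ K (#-cover low' movedIn qHeavy origin)) ⟩
      4 * (K * (# movedIn + # qHeavy))  ≡⟨ solve 3 (λ k y z → con 4 :* (k :* (y :+ z)) := con 4 :* k :* y :+ con 4 :* k :* z) refl K (# movedIn) (# qHeavy) ⟩
      4 * K * # movedIn + 4 * K * # qHeavy ≤⟨ +-mono-≤ movedIn-small (≤-trans (*-monoˡ-≤ (# qHeavy) (*-monoˡ-≤ K (ℕ.m≤n*m 4 2))) qHeavy-small) ⟩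
      n + n                             ≤⟨ ℕ.+-monoʳ-≤ n (ℕ.m≤m+n n (2 * n)) ⟩
      4 * n                             ∎)
      where
      low' movedIn : Fin n → Bool
      low' v = p' v ∧ lo v
      movedIn v = q v ∧ p' v
      light-is-high : ∀ v → T (p' v) → 2 * K * degIn G v q < n → K * n ≤ 2 * K * degIn G v p' + 2 * n
      light-is-high v p'v light = begin
        K * n                                            ≤⟨ *-monoʳ-≤ K (minDeg v) ⟩
        K * (2 * (degIn G v p + degIn G v q))            ≡⟨ solve 3 (λ k a b → k :* (con 2 :* (a :+ b)) := con 2 :* k :* a :+ con 2 :* k :* b) refl K (degIn G v p) (degIn G v q) ⟩
        2 * K * degIn G v p + 2 * K * degIn G v q        ≤⟨ +-mono-≤ (*-monoʳ-≤ (2 * K) (degIn-p≤p' v)) (<⇒≤ light) ⟩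
        2 * K * (degIn G v p' + # movedOut) + n          ≡⟨ solve 4 (λ k d x n → con 2 :* k :* (d :+ x) :+ n := con 2 :* k :* d :+ (con 2 :* k :* x :+ n)) refl K (degIn G v p') (# movedOut) n ⟩
        2 * K * degIn G v p' + (2 * K * # movedOut + n)  ≤⟨ +-monoʳ-≤ (2 * K * degIn G v p') (+-monoˡ-≤ n (≤-trans (*-monoˡ-≤ (# movedOut) (*-monoˡ-≤ K (ℕ.m≤n*m 2 2))) movedOut-small)) ⟩
        2 * K * degIn G v p' + (n + n)                   ≡⟨ cong (2 * K * degIn G v p' +_) (cong (n +_) (sym (ℕ.+-identityʳ n))) ⟩
        2 * K * degIn G v p' + 2 * n                     ∎
      origin : ∀ v → T (low' v) → T (movedIn v) ⊎ T (qHeavy v)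
      origin v lv with ∧-elim lv
      ... | p'v , lov with p∨q v
      ...   | inj₂ qv = inj₁ (∧-intro qv p'v)
      ...   | inj₁ pv with n ℕ.≤? 2 * K * degIn G v q
      ...     | yes heavy = inj₂ (∧-intro pv (≤⇒≤ᵇ heavy))
      ...     | no light  = contradiction (light-is-high v p'v (ℕ.≰⇒> light)) (low v p'v lov)

  -- The majority repartition of A ⊎ ∁A: every vertex joins the side in which
  -- it has more neighbours, ties going to A.
  majority : ∀ {n} → Graph n → Subset n → Subset n
  majority G A = tabulate (λ v → degIn G v ⟦ ∁ A ⟧ ≤ᵇ degIn G v ⟦ A ⟧)

  -- The conditions (A2)-(A3) on one side S, in integer form with 1/K for ε.
  record SideBounds {n} (K : ℕ) (G : Graph n) (S : Subset n) : Set where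
    field
      min-degree : ∀ v → v ∈ S → K * n ≤ 4 * K * deg G v S + n
      few-low    : ∀ (lo : Fin n → Bool) →
                   (∀ v → T (mem v S) → T (lo v) → ¬ (K * n ≤ 2 * K * deg G v S + 2 * n)) →
                   K * count (λ v → mem v S ∧ lo v) ≤ n

  record Bounds {n} (K : ℕ) (G : Graph n) (A : Subset n) : Set where
    field
      balanced  : K * size A ≤ K * size (∁ A) + n
      balanced′ : K * size (∁ A) ≤ K * size A + n
      side      : SideBounds K G A
      side′     : SideBounds K G (∁ A)

  half-lower : ∀ n → 2 * ⌊ n /2⌋ ≤ n
  half-lower zero          = z≤n
  half-lower (suc zero)    = z≤n
  half-lower (suc (suc n)) = ≤-trans (≤-reflexive (solve 1 (λ h → con 2 :* (con 1 :+ h) := con 2 :+ con 2 :* h) refl ⌊ n /2⌋))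
                                     (s≤s (s≤s (half-lower n)))

  half-upper : ∀ n → n ≤ 2 * ⌊ n /2⌋ + 1
  half-upper zero          = z≤n
  half-upper (suc zero)    = s≤s z≤n
  half-upper (suc (suc n)) = ≤-trans (s≤s (s≤s (half-upper n)))
    (≤-reflexive (solve 1 (λ h → con 2 :+ (con 2 :* h :+ con 1) := con 2 :* (con 1 :+ h) :+ con 1) refl ⌊ n /2⌋))

  balance-upper : ∀ K n a b h y → a + b ≡ n → a ≤ h + y → 2 * h ≤ n → 4 * K * y ≤ n → K * a ≤ K * b + n
  balance-upper K n a b h y a+b a≤h+y 2h≤n small = ℕ.+-cancelˡ-≤ (K * a) (K * a) (K * b + n) (begin
    K * a + K * a             ≤⟨ +-mono-≤ (*-monoʳ-≤ K a≤h+y) (*-monoʳ-≤ K a≤h+y) ⟩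
    K * (h + y) + K * (h + y) ≡⟨ solve 3 (λ k h y → k :* (h :+ y) :+ k :* (h :+ y) := k :* (con 2 :* h) :+ con 2 :* k :* y) refl K h y ⟩
    K * (2 * h) + 2 * K * y   ≤⟨ +-mono-≤ (*-monoʳ-≤ K 2h≤n) (≤-trans (*-monoˡ-≤ y (*-monoˡ-≤ K (ℕ.m≤n*m 2 2))) small) ⟩
    K * n + n                 ≡⟨ cong (λ m → K * m + n) (sym a+b) ⟩
    K * (a + b) + n           ≡⟨ solve 4 (λ k a b n → k :* (a :+ b) :+ n := k :* a :+ (k :* b :+ n)) refl K a b n ⟩
    K * a + (K * b + n)       ∎)
    where open ℕ.≤-Reasoning

  balance-lower : ∀ K n a b h x → a + b ≡ n → h ≤ a + x → n ≤ 2 * h + 1 → 4 * K * x ≤ n → 2 * K ≤ n →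
                  K * b ≤ K * a + n
  balance-lower K n a b h x a+b h≤a+x n≤2h+1 small 2K≤n = ℕ.+-cancelˡ-≤ (K * a) (K * b) (K * a + n) (begin
    K * a + K * b                     ≡⟨ sym (ℕ.*-distribˡ-+ K a b) ⟩
    K * (a + b)                       ≡⟨ cong (K *_) a+b ⟩
    K * n                             ≤⟨ *-monoʳ-≤ K n≤2h+1 ⟩
    K * (2 * h + 1)                   ≤⟨ *-monoʳ-≤ K (+-monoˡ-≤ 1 (*-monoʳ-≤ 2 h≤a+x)) ⟩
    K * (2 * (a + x) + 1)             ≡⟨ solve 3 (λ k a x → k :* (con 2 :* (a :+ x) :+ con 1) := k :* a :+ (k :* a :+ (con 2 :* k :* x :+ k))) refl K a x ⟩
    K * a + (K * a + (2 * K * x + K)) ≤⟨ +-monoʳ-≤ (K * a) (+-monoʳ-≤ (K * a) rest≤n) ⟩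
    K * a + (K * a + n)               ∎)
    where
    open ℕ.≤-Reasoning
    rest≤n : 2 * K * x + K ≤ n
    rest≤n = ℕ.*-cancelˡ-≤ 2 (begin
      2 * (2 * K * x + K)  ≡⟨ solve 2 (λ k x → con 2 :* (con 2 :* k :* x :+ k) := con 4 :* k :* x :+ con 2 :* k) refl K x ⟩
      4 * K * x + 2 * K    ≤⟨ +-mono-≤ small 2K≤n ⟩
      n + n                ≡⟨ cong (n +_) (sym (ℕ.+-identityʳ n)) ⟩
      2 * n                ∎)

  sideBounds : ∀ {n} (K : ℕ) (G : Graph n) (S : Subset n) →
               (∀ v → T (⟦ S ⟧ v) → K * n ≤ 4 * K * degIn G v ⟦ S ⟧ + n) →
               (∀ lo → (∀ v → T (⟦ S ⟧ v) → T (lo v) → ¬ (K * n ≤ 2 * K * degIn G v ⟦ S ⟧ + 2 * n)) →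
                       K * # (λ v → ⟦ S ⟧ v ∧ lo v) ≤ n) →
               SideBounds K G S
  sideBounds K G S min-degree few-low = record
    { min-degree = λ v v∈S → subst (λ d → _ ≤ 4 * K * d + _) (sym (deg≡degIn G v S)) (min-degree v (fromWitness v∈S))
    ; few-low    = λ lo low → subst (λ c → K * c ≤ _) (sym (count≡# (λ v → ⟦ S ⟧ v ∧ lo v)))
                     (few-low lo (λ v v∈S lov → low v v∈S lov ∘ subst (λ d → _ ≤ 2 * K * d + _) (sym (deg≡degIn G v S))))
    }

  majority-bounds : ∀ {n} (G : Graph n) (K : ℕ) .{{_ : NonZero K}} → 2 * K ≤ n → MinDegHalf G →
                    (A : Subset n) → size A ≡ ⌊ n /2⌋ → 16 * K * K * crossEdges G A ≤ n * n →
                    Bounds K G (majority G A)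
  majority-bounds {n} G K 2K≤n minDeg A |A| sparse = record
    { balanced  = subst₂ (λ a b → K * a ≤ K * b + n) (sym (size≡# A')) (sym (size≡# (∁ A')))
                    (balance-upper K n (# a') (# b') (# a) (# SB.movedOut) sizes
                      (#-cover a' a SB.movedOut a'-origin) (subst (λ h → 2 * h ≤ n) (sym |A|≡#) (half-lower n)) SB.movedOut-small)
    ; balanced′ = subst₂ (λ a b → K * b ≤ K * a + n) (sym (size≡# A')) (sym (size≡# (∁ A')))
                    (balance-lower K n (# a') (# b') (# a) (# SA.movedOut) sizes
                      (#-cover a a' SA.movedOut a-destination) (subst (λ h → n ≤ 2 * h + 1) (sym |A|≡#) (half-upper n))
                      SA.movedOut-small 2K≤n)
    ; side      = sideBounds K G A' SA.major-degree (λ lo low → SA.few-low lo low SB.movedOut-small)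
    ; side′     = sideBounds K G (∁ A') SB.major-degree (λ lo low → SB.few-low lo low SA.movedOut-small)
    }
    where
    instance
      n≢0 : NonZero n
      n≢0 = >-nonZero (≤-trans (≤-trans (>-nonZero⁻¹ K) (ℕ.m≤n*m K 2)) 2K≤n)
    A' : Subset n
    A' = majority G A
    a b a' b' : Fin n → Bool
    a  = ⟦ A ⟧
    b  = ⟦ ∁ A ⟧
    a' = ⟦ A' ⟧
    b' = ⟦ ∁ A' ⟧

    a'-major : ∀ v → T (a' v) → degIn G v b ≤ degIn G v a
    a'-major v a'v = ≤ᵇ⇒≤ _ _ (subst T (mem-tabulate _ v) a'v)
    b'-major : ∀ v → T (b' v) → degIn G v a ≤ degIn G v b
    b'-major v b'v = <⇒≤ (ℕ.≰⇒> λ b≤a →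
      ∁-excludes A' v b'v (subst T (sym (mem-tabulate _ v)) (≤⇒≤ᵇ b≤a)))

    module SA = Side G K a b a' b' (⟦⟧-cover A) (⟦⟧-cover A')
                  (minDeg-split G minDeg a b (mem-∁ A)) a'-major b'-major
                  (subst (λ e → 16 * K * K * e ≤ n * n) (crossEdges≡cut G A) sparse)
    module SB = Side G K b a b' a' (swap ∘ ⟦⟧-cover A) (swap ∘ ⟦⟧-cover A')
                  (minDeg-split G minDeg b a (mem-∁′ A)) b'-major a'-major
                  (subst (λ e → 16 * K * K * e ≤ n * n) (trans (crossEdges≡cut G A) (cut-sym G a b)) sparse)

    sizes : # a' + # b' ≡ n
    sizes = #-complement a' b' (mem-∁ A')
    |A|≡# : # a ≡ ⌊ n /2⌋
    |A|≡# = trans (sym (size≡# A)) |A|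
    a'-origin : ∀ w → T (a' w) → T (a w) ⊎ T (SB.movedOut w)
    a'-origin w a'w with ⟦⟧-cover A w
    ... | inj₁ aw = inj₁ aw
    ... | inj₂ bw = inj₂ (∧-intro bw a'w)
    a-destination : ∀ w → T (a w) → T (a' w) ⊎ T (SA.movedOut w)
    a-destination w aw with ⟦⟧-cover A' w
    ... | inj₁ a'w = inj₁ a'w
    ... | inj₂ b'w = inj₂ (∧-intro aw b'w)

module RationalBounds where

  open import Defs hiding (sym)
  open Majority using (Bounds; SideBounds)
  open import Data.Bool using (T; _∧_)
  import Data.Fin.Subset as Sub
  open import Data.Fin.Subset using (∁) renaming (∣_∣ to size)
  open import Data.Integer as ℤ using (+_; +[1+_]; +0; -[1+_])
  import Data.Integer.Properties as ℤP
  open import Data.Nat as ℕ using (ℕ; suc; z≤n; s≤s; NonZero)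
  import Data.Nat.Properties as ℕP
  import Data.Nat.Coprimality as Coprimality
  open import Data.Product using (Σ; _,_)
  open import Data.Rational as ℚ
    using (ℚ; mkℚ; 0ℚ; 1ℚ; ½; _/_; _<_; _≤_; *≤*; *<*; _+_; _*_; _-_; -_; ∣_∣; 1/_; Positive; NonNegative)
  import Data.Rational.Properties as ℚP
  import Data.Rational.Unnormalised as U
  import Data.Rational.Unnormalised.Properties as UP
  open import Data.Rational.Solver using (module +-*-Solver)
  open import Data.Sum using (inj₁; inj₂)
  open import Relation.Binary.PropositionalEquality using (_≡_; refl; sym; trans; cong; cong₂; subst; subst₂)
  open import Relation.Nullary using (¬_)
  open import Relation.Nullary.Decidable using (toWitness; ⌊_⌋)
  open +-*-Solver using (solve; _:+_; _:*_; _:-_; :-_; _:=_; con)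

  ι : ℕ → ℚ
  ι = ℕ→ℚ

  -- ι k is the normalised fraction k/1; this makes ι additive, multiplicative
  -- and an order embedding.
  ι≡mkℚ : ∀ k → ι k ≡ mkℚ (+ k) 0 (Coprimality.sym (Coprimality.1-coprimeTo k))
  ι≡mkℚ k = ℚP.normalize-coprime (Coprimality.sym (Coprimality.1-coprimeTo k))

  ι-+ : ∀ a b → ι (a ℕ.+ b) ≡ ι a + ι b
  ι-+ a b rewrite ι≡mkℚ a | ι≡mkℚ b =
    cong (_/ 1) (trans (ℤP.pos-+ a b) (sym (cong₂ ℤ._+_ (ℤP.*-identityʳ (+ a)) (ℤP.*-identityʳ (+ b)))))

  ι-* : ∀ a b → ι (a ℕ.* b) ≡ ι a * ι b
  ι-* a b rewrite ι≡mkℚ a | ι≡mkℚ b = cong (_/ 1) (ℤP.pos-* a b)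

  ι-mono : ∀ {a b} → a ℕ.≤ b → ι a ≤ ι b
  ι-mono {a} {b} a≤b rewrite ι≡mkℚ a | ι≡mkℚ b =
    *≤* (subst₂ ℤ._≤_ (sym (ℤP.*-identityʳ (+ a))) (sym (ℤP.*-identityʳ (+ b))) (ℤ.+≤+ a≤b))

  ι-cancel-≤ : ∀ {a b} → ι a ≤ ι b → a ℕ.≤ b
  ι-cancel-≤ {a} {b} ιa≤ιb rewrite ι≡mkℚ a | ι≡mkℚ b
    with subst₂ ℤ._≤_ (ℤP.*-identityʳ (+ a)) (ℤP.*-identityʳ (+ b)) (ℚP.drop-*≤* ιa≤ιb)
  ... | ℤ.+≤+ a≤b = a≤b

  ι-nonNeg : ∀ k → NonNegative (ι k)
  ι-nonNeg k = ℚ.nonNegative (ι-mono {0} {k} z≤n)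

  ι-pos : ∀ k .{{_ : NonZero k}} → Positive (ι k)
  ι-pos (suc k) = ℚ.positive (ℚP.<-≤-trans (*<* (ℤ.+<+ (s≤s z≤n))) (ι-mono {1} {suc k} (s≤s z≤n)))

  -- Every positive rational ε exceeds 1/K for some K ≥ 1: take K to be its denominator.
  archimedean : ∀ (ε : ℚ) → 0ℚ < ε → Σ ℕ λ k → 1ℚ ≤ ε * ι (suc k)
  archimedean ε@(mkℚ +[1+ p ] d _) _ = d , subst (1ℚ ≤_) (sym ε·den≡num) (ι-mono {1} {suc p} (s≤s z≤n))
    where
    toℚᵘ-ι : ∀ k → ℚ.toℚᵘ (ι k) ≡ U.mkℚᵘ (+ k) 0
    toℚᵘ-ι k = cong ℚ.toℚᵘ (ι≡mkℚ k)
    ε·den≡num : ε * ι (suc d) ≡ ι (suc p)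
    ε·den≡num = ℚP.toℚᵘ-injective (begin
      ℚ.toℚᵘ (ε * ι (suc d))                         ≈⟨ ℚP.toℚᵘ-homo-* ε (ι (suc d)) ⟩
      ℚ.toℚᵘ ε U.* ℚ.toℚᵘ (ι (suc d))                ≡⟨ cong (ℚ.toℚᵘ ε U.*_) (toℚᵘ-ι (suc d)) ⟩
      U.mkℚᵘ +[1+ p ] d U.* U.mkℚᵘ (+ suc d) 0        ≈⟨ U.*≡* cross ⟩
      U.mkℚᵘ (+ suc p) 0                              ≡⟨ sym (toℚᵘ-ι (suc p)) ⟩
      ℚ.toℚᵘ (ι (suc p))                              ∎)
      where
      open UP.≃-Reasoning
      cross : (+[1+ p ] ℤ.* + suc d) ℤ.* + 1 ≡ + suc p ℤ.* + (suc d ℕ.* 1)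
      cross = trans (ℤP.*-identityʳ _) (cong (λ m → + suc p ℤ.* + m) (sym (ℕP.*-identityʳ (suc d))))
  archimedean (mkℚ +0       _ _) (*<* (ℤ.+<+ ()))
  archimedean (mkℚ -[1+ _ ] _ _) (*<* ())

  recip : ∀ m .{{_ : NonZero m}} → ℚ
  recip m = (1/ ι m) {{ℚP.pos⇒nonZero (ι m) {{ι-pos m}}}}

  recip-pos : ∀ m .{{_ : NonZero m}} → 0ℚ < recip m
  recip-pos m = ℚP.positive⁻¹ (recip m) {{ℚP.1/pos⇒pos (ι m) {{ι-pos m}}}}

  recip-inverse : ∀ m .{{_ : NonZero m}} → recip m * ι m ≡ 1ℚ
  recip-inverse m = ℚP.*-inverseˡ (ι m) {{ℚP.pos⇒nonZero (ι m) {{ι-pos m}}}}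

  close⇒sparse : ∀ m .{{_ : NonZero m}} (γ : ℚ) e N → γ ≤ recip m → ι e ≤ γ * ι N → m ℕ.* e ℕ.≤ N
  close⇒sparse m γ e N γ≤1/m e≤γN = ι-cancel-≤ (begin
    ι (m ℕ.* e)                ≡⟨ ι-* m e ⟩
    ι m * ι e                  ≤⟨ ℚP.*-monoˡ-≤-nonNeg (ι m) {{ι-nonNeg m}} e≤γN ⟩
    ι m * (γ * ι N)            ≤⟨ ℚP.*-monoˡ-≤-nonNeg (ι m) {{ι-nonNeg m}} (ℚP.*-monoʳ-≤-nonNeg (ι N) {{ι-nonNeg N}} γ≤1/m) ⟩
    ι m * (recip m * ι N)      ≡⟨ solve 3 (λ x r y → x :* (r :* y) := (r :* x) :* y) refl (ι m) (recip m) (ι N) ⟩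
    (recip m * ι m) * ι N      ≡⟨ cong (_* ι N) (recip-inverse m) ⟩
    1ℚ * ι N                   ≡⟨ ℚP.*-identityˡ (ι N) ⟩
    ι N                        ∎)
    where open ℚP.≤-Reasoning

  module _ (ε : ℚ) (K : ℕ) (ε≥0 : 0ℚ ≤ ε) (εK≥1 : 1ℚ ≤ ε * ι K) where

    open ℚP.≤-Reasoning

    small-fraction : ∀ x n → K ℕ.* x ℕ.≤ n → ι x ≤ ε * ι n
    small-fraction x n Kx≤n = begin
      ι x                  ≡⟨ sym (ℚP.*-identityʳ (ι x)) ⟩
      ι x * 1ℚ             ≤⟨ ℚP.*-monoˡ-≤-nonNeg (ι x) {{ι-nonNeg x}} εK≥1 ⟩
      ι x * (ε * ι K)      ≡⟨ solve 3 (λ a e k → a :* (e :* k) := e :* (k :* a)) refl (ι x) ε (ι K) ⟩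
      ε * (ι K * ι x)      ≡⟨ cong (ε *_) (sym (ι-* K x)) ⟩
      ε * ι (K ℕ.* x)      ≤⟨ ℚP.*-monoˡ-≤-nonNeg ε {{ℚ.nonNegative ε≥0}} (ι-mono Kx≤n) ⟩
      ε * ι n              ∎

    large-degree : ∀ (r : ℚ) c .{{_ : NonZero c}} .{{_ : NonZero K}} d n → r * ι c ≡ 1ℚ →
                   K ℕ.* n ℕ.≤ c ℕ.* K ℕ.* d ℕ.+ c ℕ.* n → (r - ε) * ι n ≤ ι d
    large-degree r c d n rc≡1 bound = ℚP.*-cancelˡ-≤-pos (ι (c ℕ.* K)) {{ι-pos (c ℕ.* K) {{ℕP.m*n≢0 c K}}}} (begin
      ι (c ℕ.* K) * ((r - ε) * ι n)                       ≡⟨ cong (_* ((r - ε) * ι n)) (ι-* c K) ⟩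
      (ι c * ι K) * ((r - ε) * ι n)                       ≡⟨ solve 5 (λ C k R e N → (C :* k) :* ((R :- e) :* N) := (R :* C) :* (k :* N) :- (e :* k) :* (C :* N)) refl (ι c) (ι K) r ε (ι n) ⟩
      (r * ι c) * (ι K * ι n) - (ε * ι K) * (ι c * ι n)   ≡⟨ cong₂ (λ u v → u * v - (ε * ι K) * (ι c * ι n)) rc≡1 (sym (ι-* K n)) ⟩
      1ℚ * ι (K ℕ.* n) - (ε * ι K) * (ι c * ι n)          ≤⟨ ℚP.+-monoʳ-≤ (1ℚ * ι (K ℕ.* n)) (ℚP.neg-antimono-≤ (ℚP.*-monoʳ-≤-nonNeg (ι c * ι n) {{cn≥0}} εK≥1)) ⟩
      1ℚ * ι (K ℕ.* n) - 1ℚ * (ι c * ι n)                 ≤⟨ ℚP.+-monoˡ-≤ (- (1ℚ * (ι c * ι n))) (ℚP.*-monoˡ-≤-nonNeg 1ℚ {{ι-nonNeg 1}} (ι-mono bound)) ⟩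
      1ℚ * ι (c ℕ.* K ℕ.* d ℕ.+ c ℕ.* n) - 1ℚ * (ι c * ι n) ≡⟨ cong (λ u → 1ℚ * u - 1ℚ * (ι c * ι n)) (trans (ι-+ (c ℕ.* K ℕ.* d) (c ℕ.* n)) (cong (λ u → ι (c ℕ.* K ℕ.* d) + u) (ι-* c n))) ⟩
      1ℚ * (ι (c ℕ.* K ℕ.* d) + ι c * ι n) - 1ℚ * (ι c * ι n) ≡⟨ solve 2 (λ a b → con 1ℚ :* (a :+ b) :- con 1ℚ :* b := a) refl (ι (c ℕ.* K ℕ.* d)) (ι c * ι n) ⟩
      ι (c ℕ.* K ℕ.* d)                                   ≡⟨ ι-* (c ℕ.* K) d ⟩
      ι (c ℕ.* K) * ι d                                   ∎)
      where
      cn≥0 : NonNegative (ι c * ι n)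
      cn≥0 = subst NonNegative (ι-* c n) (ι-nonNeg (c ℕ.* n))

    excess-bound : ∀ a b n → b ℕ.≤ a → K ℕ.* a ℕ.≤ K ℕ.* b ℕ.+ n → ∣ ι a - ι b ∣ ≤ ε * ι n
    excess-bound a b n b≤a a≲b = subst (_≤ ε * ι n) (sym ∣ιa-ιb∣≡) (small-fraction (a ℕ.∸ b) n K[a-b]≤n)
      where
      a≡ : a ≡ (a ℕ.∸ b) ℕ.+ b
      a≡ = sym (ℕP.m∸n+n≡m b≤a)
      K[a-b]≤n : K ℕ.* (a ℕ.∸ b) ℕ.≤ n
      K[a-b]≤n = ℕP.+-cancelʳ-≤ (K ℕ.* b) _ n (subst₂ ℕ._≤_
        (trans (cong (K ℕ.*_) a≡) (ℕP.*-distribˡ-+ K (a ℕ.∸ b) b)) (ℕP.+-comm (K ℕ.* b) n) a≲b)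
      ∣ιa-ιb∣≡ : ∣ ι a - ι b ∣ ≡ ι (a ℕ.∸ b)
      ∣ιa-ιb∣≡ = trans (cong ∣_∣ (trans (cong (λ m → ι m - ι b) a≡)
                   (trans (cong (_- ι b) (ι-+ (a ℕ.∸ b) b)) (solve 2 (λ x y → (x :+ y) :- y := x) refl (ι (a ℕ.∸ b)) (ι b)))))
                   (ℚP.0≤p⇒∣p∣≡p (ι-mono {0} {a ℕ.∸ b} z≤n))

    close-sizes : ∀ a b n → K ℕ.* a ℕ.≤ K ℕ.* b ℕ.+ n → K ℕ.* b ℕ.≤ K ℕ.* a ℕ.+ n → ∣ ι a - ι b ∣ ≤ ε * ι n
    close-sizes a b n a≲b b≲a with ℕP.≤-total b a
    ... | inj₁ b≤a = excess-bound a b n b≤a a≲b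
    ... | inj₂ a≤b = subst (_≤ ε * ι n) (trans (sym (ℚP.∣-p∣≡∣p∣ (ι b - ι a))) (cong ∣_∣ (solve 2 (λ x y → :- (y :- x) := x :- y) refl (ι a) (ι b))))
                           (excess-bound b a n a≤b b≲a)

  module _ (ε : ℚ) (K : ℕ) .{{_ : NonZero K}} (ε≥0 : 0ℚ ≤ ε) (εK≥1 : 1ℚ ≤ ε * ι K) {n} (G : Graph n) where

    side-min-degree : ∀ {S} → SideBounds K G S → ∀ v → v Sub.∈ S → (+ 1 / 4 - ε) * ι n ≤ ι (deg G v S)
    side-min-degree {S} bounds v v∈S = large-degree ε K ε≥0 εK≥1 (+ 1 / 4) 4 (deg G v S) n refl
      (ℕP.≤-trans (SideBounds.min-degree bounds v v∈S) (ℕP.+-monoʳ-≤ _ (ℕP.m≤n*m n 4)))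

    -- (A2)/(A4) for one side: a vertex of degree below (1/2 - ε)n violates the
    -- integer degree bound, so such vertices are among the few counted by few-low.
    side-few-low : ∀ {S} → SideBounds K G S →
                   ι (count (λ v → mem v S ∧ ⌊ ι (deg G v S) ℚ.<? (½ - ε) * ι n ⌋)) ≤ ε * ι n
    side-few-low {S} bounds = small-fraction ε K ε≥0 εK≥1 _ n (SideBounds.few-low bounds _ not-low)
      where
      not-low : ∀ v → T (mem v S) → T ⌊ ι (deg G v S) ℚ.<? (½ - ε) * ι n ⌋ →
                ¬ (K ℕ.* n ℕ.≤ 2 ℕ.* K ℕ.* deg G v S ℕ.+ 2 ℕ.* n)
      not-low v _ low bound = ℚP.<-irrefl refl (ℚP.<-≤-trans (toWitness low)
        (large-degree ε K ε≥0 εK≥1 ½ 2 (deg G v S) n refl bound))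

    superextremal : ∀ {A} → Bounds K G A → Superextremal ε G A
    superextremal {A} bounds =
        close-sizes ε K ε≥0 εK≥1 (size A) (size (∁ A)) n balanced balanced′
      , side-few-low side , side-min-degree side , side-few-low side′ , side-min-degree side′
      where open Bounds bounds

open import Defs
open import Data.Nat using (ℕ; _≥_)
open import Data.Rational using (ℚ; 0ℚ; _<_; _≤_)
open import Data.Fin.Subset using (Subset)
open import Data.Product using (Σ; ∃; _×_)
open import Data.Integer using (+<+)
open import Data.Nat using (suc; _*_; s≤s; z≤n)
open import Data.Product using (_,_)
open import Data.Rational using (1ℚ; *<*)
open import Data.Rational.Properties using (<⇒≤)
open Attachment using (crossCondition)
open Majority using (majority; majority-bounds)
open RationalBounds using (archimedean; recip; recip-pos; close⇒sparse; superextremal)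

lemma15 : Σ ℚ λ ε₀ → 0ℚ < ε₀ × (∀ (ε : ℚ) → 0ℚ < ε → ε ≤ ε₀ →
            Σ ℚ λ γ₀ → 0ℚ < γ₀ × (∀ (γ : ℚ) → 0ℚ < γ → γ ≤ γ₀ →
              Σ ℕ λ n₀ → ∀ (n : ℕ) → n ≥ n₀ → (G : Graph n) →
                MinDegHalf G → Close γ G →
                Σ (Subset n) λ A → Superextremal ε G A × CrossCondition G A))
lemma15 = 1ℚ , *<* (+<+ (s≤s z≤n)) , λ ε ε>0 _ →
  let k , εK≥1 = archimedean ε ε>0
      K = suc k
  in recip (16 * K * K) , recip-pos (16 * K * K) , λ γ _ γ≤γ₀ →
     2 * K , λ n n≥2K G minDeg (A , |A| , close) →
         majority G A
       , superextremal ε K (<⇒≤ ε>0) εK≥1 G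
           (majority-bounds G K n≥2K minDeg A |A| (close⇒sparse (16 * K * K) γ _ _ γ≤γ₀ close))
       , crossCondition G minDeg (majority G A)
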